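{- $\{[\omega:1,1:1],[\omega:1,2:1]\}\not\leq_{\textnormal{Scott}}\{[1:\omega],[2:\omega]\}$, where each of these classes denotes the class of all equivalence structures with domain contained in $\omega$ isomorphic to one of the listed structures.
   Context: Equivalence structures are structures $(A;\sim)$ in signature $\{\sim,=,\neq\}$ (so $x\neq y$ is a positive atomic formula) with domain $A\subseteq\omega$ and $\sim$ an equivalence relation; $[\alpha_1:\beta_1,\dots,\alpha_n:\beta_n]$ denotes the equivalence structure with exactly $\beta_i$ equivalence classes of size $\alpha_i$ for each $i$ and no other classes. For a structure $\mathcal{A}$, $\mathcal{D}_+(\mathcal{A})$ is the set of Gödel numbers of the positive atomic sentences (in the signature extended by constants for natural numbers) true in $\mathcal{A}$, a subset of $\omega$. A map $\Gamma:\mathcal{P}(\omega)\to\mathcal{P}(\omega)$ is Scott-continuous iff it is monotone ($A\subseteq B\Rightarrow\Gamma(A)\subseteq\Gamma(B)$) and $x\in\Gamma(A)$ iff $x\in\Gamma(D)$ for some finite $D\subseteq A$. $\mathfrak{K}_0\leq_{\textnormal{Scott}}\mathfrak{K}_1$ means there is a Scott-continuous $\Gamma$ such that for every $\mathcal{A}\in\mathfrak{K}_0$, $\Gamma(\mathcal{D}_+(\mathcal{A}))$ is the positive atomic diagram of a structure $\Gamma(\mathcal{A})\in\mathfrak{K}_1$, and for all $\mathcal{A},\mathcal{B}\in\mathfrak{K}_0$: $\mathcal{A}\cong\mathcal{B}$ iff $\Gamma(\mathcal{A})\cong\Gamma(\mathcal{B})$. -}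

module Defs where

import Level
open import Level using (0ℓ)
open import Data.Nat using (ℕ; zero; suc; _+_; _*_; _^_; _/_)
open import Data.Product using (Σ; ∃; _×_; _,_)
open import Data.List using (List)
open import Data.List.Membership.Propositional using (_∈_)
open import Relation.Binary.PropositionalEquality using (_≡_)
open import Relation.Nullary using (¬_)
open import Function.Bundles using (_⇔_)
open import Data.Bool using (true; false)
open import Data.Nat using (_<ᵇ_)
open import Data.Unit using (⊤; tt)
open import Data.Sum using (_⊎_)
open import Level using (Lift)

Subset : Set₁
Subset = ℕ → Set

_⊆_ : Subset → Subset → Set
A ⊆ B = ∀ n → A n → B n

_≐_ : Subset → Subset → Set
A ≐ B = ∀ n → A n ⇔ B n

⟦_⟧ : List ℕ → Subset
⟦ D ⟧ n = n ∈ D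

record ScottContinuous (Γ : Subset → Subset) : Set₁ where
  field
    monotone   : ∀ A B → A ⊆ B → Γ A ⊆ Γ B
    continuous : ∀ A x → Γ A x ⇔ (Σ (List ℕ) λ D → (⟦ D ⟧ ⊆ A) × Γ ⟦ D ⟧ x)

record EqStr : Set₁ where
  field
    Dom    : ℕ → Set
    _∼_    : ℕ → ℕ → Set
    ∼-dom  : ∀ {x y} → x ∼ y → Dom x × Dom y
    ∼-refl : ∀ {x} → Dom x → x ∼ x
    ∼-sym  : ∀ {x y} → x ∼ y → y ∼ x
    ∼-trans : ∀ {x y z} → x ∼ y → y ∼ z → x ∼ z

open EqStr public

record _≅_ (𝒜 ℬ : EqStr) : Set where
  field
    f     : ℕ → ℕ
    g     : ℕ → ℕ
    f-dom : ∀ x → Dom 𝒜 x → Dom ℬ (f x)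
    g-dom : ∀ y → Dom ℬ y → Dom 𝒜 (g y)
    gf    : ∀ x → Dom 𝒜 x → g (f x) ≡ x
    fg    : ∀ y → Dom ℬ y → f (g y) ≡ y
    pres  : ∀ x y → Dom 𝒜 x → Dom 𝒜 y → (_∼_ 𝒜 x y ⇔ _∼_ ℬ (f x) (f y))

-- Positive atomic sentences in the signature {∼, =, ≠} with constants
-- for natural numbers, their Gödel numbers, and the positive atomic diagram

data Sentence : Set where
  eqS  : ℕ → ℕ → Sentence
  neqS : ℕ → ℕ → Sentence
  simS : ℕ → ℕ → Sentence

⌜_⌝ : Sentence → ℕ
⌜ eqS  i j ⌝ = 3 * (2 ^ i * suc (2 * j))
⌜ neqS i j ⌝ = 1 + 3 * (2 ^ i * suc (2 * j))
⌜ simS i j ⌝ = 2 + 3 * (2 ^ i * suc (2 * j))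

-- truth of a positive atomic sentence (constants must name domain elements)
_⊨_ : EqStr → Sentence → Set
𝒜 ⊨ eqS  i j = Dom 𝒜 i × Dom 𝒜 j × i ≡ j
𝒜 ⊨ neqS i j = Dom 𝒜 i × Dom 𝒜 j × ¬ (i ≡ j)
𝒜 ⊨ simS i j = _∼_ 𝒜 i j

D₊ : EqStr → Subset
D₊ 𝒜 n = Σ Sentence λ φ → (⌜ φ ⌝ ≡ n) × (𝒜 ⊨ φ)

Class : Set₁
Class = EqStr → Set

_≤Scott_ : Class → Class → Set₁
𝔎₀ ≤Scott 𝔎₁ =
  Σ (Subset → Subset) λ Γ →
    ScottContinuous Γ
    × (∀ 𝒜 → 𝔎₀ 𝒜 → Σ EqStr λ ℬ → 𝔎₁ ℬ × (Γ (D₊ 𝒜) ≐ D₊ ℬ))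
    × (∀ 𝒜 ℬ 𝒞 𝒟 → 𝔎₀ 𝒜 → 𝔎₀ ℬ →
         Γ (D₊ 𝒜) ≐ D₊ 𝒞 → Γ (D₊ ℬ) ≐ D₊ 𝒟 →
         (𝒜 ≅ ℬ) ⇔ (𝒞 ≅ 𝒟))

private
  trans≡ : ∀ {a b c : ℕ} → a ≡ b → b ≡ c → a ≡ c
  trans≡ _≡_.refl q = q
  sym≡ : ∀ {a b : ℕ} → a ≡ b → b ≡ a
  sym≡ _≡_.refl = _≡_.refl


kernel : (ℕ → ℕ) → EqStr
kernel h = record
  { Dom = λ _ → ⊤
  ; _∼_ = λ x y → h x ≡ h y
  ; ∼-dom = λ _ → tt , tt
  ; ∼-refl = λ _ → _≡_.refl
  ; ∼-sym = sym≡
  ; ∼-trans = trans≡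
  }

-- [ω:1, k:1] : the class {0,…,k-1} (size k) and the infinite class {k, k+1, …}
ωk : ℕ → ℕ → ℕ
ωk k x with x <ᵇ k
... | true  = 0
... | false = 1

[ω:1,1:1] : EqStr
[ω:1,1:1] = kernel (ωk 1)

[ω:1,2:1] : EqStr
[ω:1,2:1] = kernel (ωk 2)

-- [1:ω] : infinitely many singleton classes
[1:ω] : EqStr
[1:ω] = kernel (λ x → x)

-- [2:ω] : infinitely many classes {2m, 2m+1} of size 2
[2:ω] : EqStr
[2:ω] = kernel (λ x → x / 2)

IsoClass₂ : EqStr → EqStr → Class
IsoClass₂ 𝒜 ℬ 𝒞 = (𝒞 ≅ 𝒜) ⊎ (𝒞 ≅ ℬ)

-- Inside ω there are copies 𝒮 ≅ [ω:1,1:1] and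
-- 𝒯 ≅ [ω:1,2:1] with D₊ 𝒮 ⊆ D₊ 𝒯 ⊆ D₊ [ω:1,1:1]: remove 2 from the finite class of
-- 𝒯 = {1,2} ∪ {3,4,…}, and join the two classes of 𝒯 (adding 0 as a singleton).
-- Their images are a chain 𝒞 ⊆ 𝒟 ⊆ ℰ of structures in {[1:ω], [2:ω]} with 𝒞 ≅ ℰ but
-- 𝒞 ≇ 𝒟. That is impossible: a non-trivial ∼-pair survives diagram inclusion, so
-- along such a chain one can only pass from [1:ω] to [2:ω], never back.
module Submission where

open import Defs
open import Data.Nat using (ℕ; zero; suc; pred; _+_; _*_; _^_; _%_; NonZero)
open import Data.Nat.Properties using (suc-injective; *-comm; *-assoc; *-identityˡ; +-cancelˡ-≡; *-cancelˡ-≡)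
open import Data.Nat.DivMod using ([m+kn]%n≡m%n)
open import Data.Product using (Σ; _×_; _,_; proj₁; proj₂)
open import Data.Sum using (inj₁; inj₂)
open import Data.Empty using (⊥-elim)
open import Data.Unit using (tt)
open import Function.Bundles using (mk⇔; Equivalence)
open import Relation.Nullary using (¬_)
open import Relation.Binary.PropositionalEquality using (_≡_; _≢_; refl; sym; trans; cong; cong₂; subst; subst₂; module ≡-Reasoning)

open Equivalence using (to; from)

[m+n*k]%n≡m%n : ∀ m n k .{{_ : NonZero n}} → (m + n * k) % n ≡ m % n
[m+n*k]%n≡m%n m n k = trans (cong (λ t → (m + t) % n) (*-comm n k)) ([m+kn]%n≡m%n m k n)

1+2*m≢2*n : ∀ m n → suc (2 * m) ≢ 2 * n
1+2*m≢2*n m n e with trans (sym ([m+n*k]%n≡m%n 1 2 m)) (trans (cong (_% 2) e) ([m+n*k]%n≡m%n 0 2 n))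
... | ()

pairing : ℕ × ℕ → ℕ
pairing (i , j) = 2 ^ i * suc (2 * j)

pairing-injective : ∀ p q → pairing p ≡ pairing q → p ≡ q
pairing-injective (zero , j) (zero , j′) e =
  cong (zero ,_) (*-cancelˡ-≡ j j′ 2 (suc-injective (trans (sym (*-identityˡ _)) (trans e (*-identityˡ _)))))
pairing-injective (zero , j) (suc i′ , j′) e =
  ⊥-elim (1+2*m≢2*n j (2 ^ i′ * suc (2 * j′)) (trans (sym (*-identityˡ _)) (trans e (*-assoc 2 (2 ^ i′) (suc (2 * j′))))))
pairing-injective (suc i , j) (zero , j′) e =
  ⊥-elim (1+2*m≢2*n j′ (2 ^ i * suc (2 * j)) (trans (sym (*-identityˡ _)) (trans (sym e) (*-assoc 2 (2 ^ i) (suc (2 * j))))))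
pairing-injective (suc i , j) (suc i′ , j′) e
  with pairing-injective (i , j) (i′ , j′)
         (*-cancelˡ-≡ _ _ 2 (trans (sym (*-assoc 2 (2 ^ i) _)) (trans e (*-assoc 2 (2 ^ i′) _))))
... | refl = refl

tag : Sentence → ℕ
tag (eqS _ _)  = 0
tag (neqS _ _) = 1
tag (simS _ _) = 2

operands : Sentence → ℕ × ℕ
operands (eqS i j)  = i , j
operands (neqS i j) = i , j
operands (simS i j) = i , j

decode : ℕ → ℕ × ℕ → Sentence
decode 0 (i , j) = eqS i j
decode 1 (i , j) = neqS i j
decode _ (i , j) = simS i j

decode-tag-operands : ∀ φ → decode (tag φ) (operands φ) ≡ φ
decode-tag-operands (eqS _ _)  = refl
decode-tag-operands (neqS _ _) = refl
decode-tag-operands (simS _ _) = refl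

⌜⌝≡tag+3*pairing : ∀ φ → ⌜ φ ⌝ ≡ tag φ + 3 * pairing (operands φ)
⌜⌝≡tag+3*pairing (eqS _ _)  = refl
⌜⌝≡tag+3*pairing (neqS _ _) = refl
⌜⌝≡tag+3*pairing (simS _ _) = refl

tag%3≡tag : ∀ φ → tag φ % 3 ≡ tag φ
tag%3≡tag (eqS _ _)  = refl
tag%3≡tag (neqS _ _) = refl
tag%3≡tag (simS _ _) = refl

⌜⌝-injective : ∀ φ ψ → ⌜ φ ⌝ ≡ ⌜ ψ ⌝ → φ ≡ ψ
⌜⌝-injective φ ψ e = begin
  φ                                   ≡⟨ sym (decode-tag-operands φ) ⟩
  decode (tag φ) (operands φ)         ≡⟨ cong₂ decode same-tag same-operands ⟩
  decode (tag ψ) (operands ψ)         ≡⟨ decode-tag-operands ψ ⟩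
  ψ                                   ∎
  where
    open ≡-Reasoning
    split : tag φ + 3 * pairing (operands φ) ≡ tag ψ + 3 * pairing (operands ψ)
    split = trans (sym (⌜⌝≡tag+3*pairing φ)) (trans e (⌜⌝≡tag+3*pairing ψ))
    same-tag : tag φ ≡ tag ψ
    same-tag = begin
      tag φ                                     ≡⟨ sym (tag%3≡tag φ) ⟩
      tag φ % 3                                 ≡⟨ sym ([m+n*k]%n≡m%n (tag φ) 3 (pairing (operands φ))) ⟩
      (tag φ + 3 * pairing (operands φ)) % 3    ≡⟨ cong (_% 3) split ⟩
      (tag ψ + 3 * pairing (operands ψ)) % 3    ≡⟨ [m+n*k]%n≡m%n (tag ψ) 3 (pairing (operands ψ)) ⟩
      tag ψ % 3                                 ≡⟨ tag%3≡tag ψ ⟩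
      tag ψ                                     ∎
    same-operands : operands φ ≡ operands ψ
    same-operands = pairing-injective _ _ (*-cancelˡ-≡ _ _ 3
      (+-cancelˡ-≡ (tag φ) _ _ (trans split (cong (_+ _) (sym same-tag)))))

≅-refl : ∀ {𝒜} → 𝒜 ≅ 𝒜
≅-refl = record
  { f = λ x → x ; g = λ y → y ; f-dom = λ _ d → d ; g-dom = λ _ d → d
  ; gf = λ _ _ → refl ; fg = λ _ _ → refl ; pres = λ _ _ _ _ → mk⇔ (λ r → r) (λ r → r) }

≅-sym : ∀ {𝒜 ℬ} → 𝒜 ≅ ℬ → ℬ ≅ 𝒜
≅-sym {𝒜} {ℬ} i = record
  { f = g ; g = f ; f-dom = g-dom ; g-dom = f-dom ; gf = fg ; fg = gf
  ; pres = λ y y′ dy dy′ →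
      let p = pres (g y) (g y′) (g-dom y dy) (g-dom y′ dy′)
      in mk⇔ (λ r → from p (subst₂ (_∼_ ℬ) (sym (fg y dy)) (sym (fg y′ dy′)) r))
             (λ r → subst₂ (_∼_ ℬ) (fg y dy) (fg y′ dy′) (to p r)) }
  where open _≅_ i

≅-trans : ∀ {𝒜 ℬ 𝒞} → 𝒜 ≅ ℬ → ℬ ≅ 𝒞 → 𝒜 ≅ 𝒞
≅-trans i j = record
  { f = λ x → J.f (I.f x) ; g = λ z → I.g (J.g z)
  ; f-dom = λ x d → J.f-dom _ (I.f-dom x d)
  ; g-dom = λ z d → I.g-dom _ (J.g-dom z d)
  ; gf = λ x d → trans (cong I.g (J.gf _ (I.f-dom x d))) (I.gf x d)
  ; fg = λ z d → trans (cong J.f (I.fg _ (J.g-dom z d))) (J.fg z d)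
  ; pres = λ x y dx dy →
      let p = I.pres x y dx dy
          q = J.pres _ _ (I.f-dom x dx) (I.f-dom y dy)
      in mk⇔ (λ r → to q (to p r)) (λ r → from p (from q r)) }
  where
    module I = _≅_ i
    module J = _≅_ j

_⊑_ : EqStr → EqStr → Set
𝒜 ⊑ ℬ = (Dom 𝒜 ⊆ Dom ℬ) × (∀ x y → _∼_ 𝒜 x y → _∼_ ℬ x y)

⊑⇒D₊⊆ : ∀ {𝒜 ℬ} → 𝒜 ⊑ ℬ → D₊ 𝒜 ⊆ D₊ ℬ
⊑⇒D₊⊆ (dom , _) _ (eqS i j , e , di , dj , p)  = eqS i j , e , dom i di , dom j dj , p
⊑⇒D₊⊆ (dom , _) _ (neqS i j , e , di , dj , p) = neqS i j , e , dom i di , dom j dj , p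
⊑⇒D₊⊆ (_ , rel) _ (simS i j , e , r)           = simS i j , e , rel i j r

D₊⊆⇒∼⊆ : ∀ {𝒜 ℬ} → D₊ 𝒜 ⊆ D₊ ℬ → ∀ x y → _∼_ 𝒜 x y → _∼_ ℬ x y
D₊⊆⇒∼⊆ 𝒜⊆ℬ x y r with 𝒜⊆ℬ _ (simS x y , refl , r)
... | φ , e , t with ⌜⌝-injective φ (simS x y) e
... | refl = t

Discrete : EqStr → Set
Discrete 𝒜 = ∀ x y → _∼_ 𝒜 x y → x ≡ y

D₊⊆-discrete : ∀ {𝒜 ℬ} → D₊ 𝒜 ⊆ D₊ ℬ → Discrete ℬ → Discrete 𝒜
D₊⊆-discrete 𝒜⊆ℬ δ x y r = δ x y (D₊⊆⇒∼⊆ 𝒜⊆ℬ x y r)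

≅-discrete : ∀ {𝒜 ℬ} → 𝒜 ≅ ℬ → Discrete ℬ → Discrete 𝒜
≅-discrete {𝒜} i δ x y r = begin
  x          ≡⟨ sym (gf x dx) ⟩
  g (f x)    ≡⟨ cong g (δ (f x) (f y) (to (pres x y dx dy) r)) ⟩
  g (f y)    ≡⟨ gf y dy ⟩
  y          ∎
  where
    open _≅_ i
    open ≡-Reasoning
    dx = proj₁ (∼-dom 𝒜 r)
    dy = proj₂ (∼-dom 𝒜 r)

[1:ω]-discrete : Discrete [1:ω]
[1:ω]-discrete _ _ e = e

[2:ω]-not-discrete : ¬ Discrete [2:ω]
[2:ω]-not-discrete δ with δ 0 1 refl
... | ()

K₁ : Class
K₁ = IsoClass₂ [1:ω] [2:ω]

K₁-sandwich : ∀ {𝒞 𝒟 ℰ} → K₁ 𝒞 → K₁ 𝒟 → K₁ ℰ → D₊ 𝒞 ⊆ D₊ 𝒟 → D₊ 𝒟 ⊆ D₊ ℰ → 𝒞 ≅ ℰ → 𝒞 ≅ 𝒟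
K₁-sandwich (inj₁ 𝒞≅) (inj₁ 𝒟≅) _ _ _ _ = ≅-trans 𝒞≅ (≅-sym 𝒟≅)
K₁-sandwich (inj₂ 𝒞≅) (inj₁ 𝒟≅) _ 𝒞⊆𝒟 _ _ =
  ⊥-elim ([2:ω]-not-discrete (≅-discrete (≅-sym 𝒞≅) (D₊⊆-discrete 𝒞⊆𝒟 (≅-discrete 𝒟≅ [1:ω]-discrete))))
K₁-sandwich _ (inj₂ 𝒟≅) (inj₁ ℰ≅) _ 𝒟⊆ℰ _ =
  ⊥-elim ([2:ω]-not-discrete (≅-discrete (≅-sym 𝒟≅) (D₊⊆-discrete 𝒟⊆ℰ (≅-discrete ℰ≅ [1:ω]-discrete))))
K₁-sandwich _ (inj₂ 𝒟≅) (inj₂ ℰ≅) _ _ 𝒞≅ℰ = ≅-trans 𝒞≅ℰ (≅-trans ℰ≅ (≅-sym 𝒟≅))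

HasSingletonClass : EqStr → Set
HasSingletonClass 𝒜 = Σ ℕ λ x → Dom 𝒜 x × (∀ y → _∼_ 𝒜 x y → y ≡ x)

≅-singleton : ∀ {𝒜 ℬ} → 𝒜 ≅ ℬ → HasSingletonClass 𝒜 → HasSingletonClass ℬ
≅-singleton {𝒜} {ℬ} i (x , dx , single) = f x , f-dom x dx , λ y r →
  let dy = proj₂ (∼-dom ℬ r)
      r′ = from (pres x (g y) dx (g-dom y dy)) (subst (_∼_ ℬ (f x)) (sym (fg y dy)) r)
  in trans (sym (fg y dy)) (cong f (single (g y) r′))
  where open _≅_ i

[ω:1,1:1]-singleton : HasSingletonClass [ω:1,1:1]
[ω:1,1:1]-singleton = 0 , tt , λ { zero _ → refl ; (suc _) () }

[ω:1,2:1]-no-singleton : ¬ HasSingletonClass [ω:1,2:1]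
[ω:1,2:1]-no-singleton (0 , _ , single) with single 1 refl
... | ()
[ω:1,2:1]-no-singleton (1 , _ , single) with single 0 refl
... | ()
[ω:1,2:1]-no-singleton (suc (suc k) , _ , single) with single (suc (suc (suc k))) refl
... | ()

[ω:1,1:1]≇[ω:1,2:1] : ¬ ([ω:1,1:1] ≅ [ω:1,2:1])
[ω:1,1:1]≇[ω:1,2:1] i = [ω:1,2:1]-no-singleton (≅-singleton i [ω:1,1:1]-singleton)

restrictedKernel : (ℕ → Set) → (ℕ → ℕ) → EqStr
restrictedKernel P h = record
  { Dom = P
  ; _∼_ = λ x y → P x × P y × (h x ≡ h y)
  ; ∼-dom = λ { (px , py , _) → px , py }
  ; ∼-refl = λ p → p , p , refl
  ; ∼-sym = λ { (px , py , e) → py , px , sym e }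
  ; ∼-trans = λ { (px , _ , e) (_ , pz , e′) → px , pz , trans e e′ }
  }

restrictedKernel≅kernel : ∀ P h h′ (f g : ℕ → ℕ) → (∀ y → P (g y)) → (∀ x → P x → g (f x) ≡ x) →
  (∀ y → f (g y) ≡ y) → (∀ x → P x → h x ≡ h′ (f x)) → restrictedKernel P h ≅ kernel h′
restrictedKernel≅kernel P h h′ f g g-dom gf fg h≡h′∘f = record
  { f = f ; g = g ; f-dom = λ _ _ → tt ; g-dom = λ y _ → g-dom y
  ; gf = gf ; fg = λ y _ → fg y
  ; pres = λ x y px py → mk⇔
      (λ { (_ , _ , e) → trans (sym (h≡h′∘f x px)) (trans e (h≡h′∘f y py)) })
      (λ e → px , py , trans (h≡h′∘f x px) (trans e (sym (h≡h′∘f y py)))) }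

data Positive : ℕ → Set where
  positive : ∀ k → Positive (suc k)

data PositiveExcept2 : ℕ → Set where
  one   : PositiveExcept2 1
  ≥3    : ∀ k → PositiveExcept2 (suc (suc (suc k)))

𝒯 : EqStr
𝒯 = restrictedKernel Positive (ωk 3)

𝒮 : EqStr
𝒮 = restrictedKernel PositiveExcept2 (ωk 3)

𝒯≅[ω:1,2:1] : 𝒯 ≅ [ω:1,2:1]
𝒯≅[ω:1,2:1] = restrictedKernel≅kernel Positive (ωk 3) (ωk 2) pred suc positive
  (λ { _ (positive _) → refl }) (λ _ → refl)
  (λ { _ (positive zero) → refl ; _ (positive (suc zero)) → refl ; _ (positive (suc (suc _))) → refl })

𝒮≅[ω:1,1:1] : 𝒮 ≅ [ω:1,1:1]
𝒮≅[ω:1,1:1] = restrictedKernel≅kernel PositiveExcept2 (ωk 3) (ωk 1) collapse expand expand-dom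
  (λ { _ one → refl ; _ (≥3 _) → refl }) (λ { zero → refl ; (suc _) → refl })
  (λ { _ one → refl ; _ (≥3 _) → refl })
  where
    collapse : ℕ → ℕ
    collapse (suc (suc (suc k))) = suc k
    collapse _                   = 0
    expand : ℕ → ℕ
    expand zero    = 1
    expand (suc k) = suc (suc (suc k))
    expand-dom : ∀ y → PositiveExcept2 (expand y)
    expand-dom zero    = one
    expand-dom (suc k) = ≥3 k

𝒮⊑𝒯 : 𝒮 ⊑ 𝒯
𝒮⊑𝒯 = (λ _ → positive′) , λ { _ _ (px , py , e) → positive′ px , positive′ py , e }
  where
    positive′ : ∀ {x} → PositiveExcept2 x → Positive x
    positive′ one    = positive 0
    positive′ (≥3 k) = positive (suc (suc k))

𝒯⊑[ω:1,1:1] : 𝒯 ⊑ [ω:1,1:1]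
𝒯⊑[ω:1,1:1] = (λ _ _ → tt) , λ { _ _ (positive _ , positive _ , _) → refl }

image-⊆ : ∀ {Γ 𝒜 ℬ 𝒞 𝒟} → ScottContinuous Γ → D₊ 𝒜 ⊆ D₊ ℬ →
  Γ (D₊ 𝒜) ≐ D₊ 𝒞 → Γ (D₊ ℬ) ≐ D₊ 𝒟 → D₊ 𝒞 ⊆ D₊ 𝒟
image-⊆ Γ-scott 𝒜⊆ℬ Γ𝒜≐𝒞 Γℬ≐𝒟 n φ =
  to (Γℬ≐𝒟 n) (ScottContinuous.monotone Γ-scott _ _ 𝒜⊆ℬ n (from (Γ𝒜≐𝒞 n) φ))

proposition6 : ¬ (IsoClass₂ [ω:1,1:1] [ω:1,2:1] ≤Scott IsoClass₂ [1:ω] [2:ω])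
proposition6 (Γ , Γ-scott , Γ-total , Γ-iso)
  with Γ-total 𝒮 (inj₁ 𝒮≅[ω:1,1:1]) | Γ-total 𝒯 (inj₂ 𝒯≅[ω:1,2:1]) | Γ-total [ω:1,1:1] (inj₁ ≅-refl)
... | 𝒞 , 𝒞∈K₁ , Γ𝒮≐𝒞 | 𝒟 , 𝒟∈K₁ , Γ𝒯≐𝒟 | ℰ , ℰ∈K₁ , ΓU≐ℰ =
  [ω:1,1:1]≇[ω:1,2:1] (≅-trans (≅-sym 𝒮≅[ω:1,1:1]) (≅-trans 𝒮≅𝒯 𝒯≅[ω:1,2:1]))
  where
    𝒞⊆𝒟 : D₊ 𝒞 ⊆ D₊ 𝒟
    𝒞⊆𝒟 = image-⊆ Γ-scott (⊑⇒D₊⊆ 𝒮⊑𝒯) Γ𝒮≐𝒞 Γ𝒯≐𝒟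
    𝒟⊆ℰ : D₊ 𝒟 ⊆ D₊ ℰ
    𝒟⊆ℰ = image-⊆ Γ-scott (⊑⇒D₊⊆ 𝒯⊑[ω:1,1:1]) Γ𝒯≐𝒟 ΓU≐ℰ
    𝒞≅ℰ : 𝒞 ≅ ℰ
    𝒞≅ℰ = to (Γ-iso 𝒮 [ω:1,1:1] 𝒞 ℰ (inj₁ 𝒮≅[ω:1,1:1]) (inj₁ ≅-refl) Γ𝒮≐𝒞 ΓU≐ℰ) 𝒮≅[ω:1,1:1]
    𝒮≅𝒯 : 𝒮 ≅ 𝒯
    𝒮≅𝒯 = from (Γ-iso 𝒮 𝒯 𝒞 𝒟 (inj₁ 𝒮≅[ω:1,1:1]) (inj₂ 𝒯≅[ω:1,2:1]) Γ𝒮≐𝒞 Γ𝒯≐𝒟)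
             (K₁-sandwich 𝒞∈K₁ 𝒟∈K₁ ℰ∈K₁ 𝒞⊆𝒟 𝒟⊆ℰ 𝒞≅ℰ)
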